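{- Let $n\ge1$ and let $G_n$ be the linear crossed polyomino chain with $n$ four-order complete graphs. Then its Kirchhoff index is $$K\!f(G_n)=\frac{(n+1)(n+2)^2}{6}.$$
   Context: For $n\geq1$, $G_n$ is the simple graph with vertex set $\{1,\ldots,n+1\}\cup\{1',\ldots,(n+1)'\}$ and edge set consisting of the vertical edges $ii'$ for $1\le i\le n+1$ together with, for each $1\le i\le n$, the edges $i(i+1)$, $i'(i+1)'$, $i(i+1)'$, $i'(i+1)$. The resistance distance $r_{uv}$ is the effective resistance between $u$ and $v$ when each edge is a unit resistor, and the Kirchhoff index is $K\!f(G)=\sum_{\{u,v\}} r_{uv}$, summed over unordered pairs of distinct vertices. -}

module Defs where

open import Data.Nat as ℕ using (ℕ; suc; _+_; _*_)
open import Data.Nat.Properties using (_≟_)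
open import Data.Integer using (+_)
open import Data.Rational using (ℚ; 0ℚ; 1ℚ; _/_) renaming (_+_ to _+ℚ_; _-_ to _-ℚ_)
open import Data.Fin using (Fin; toℕ)
open import Data.List using (List; []; _∷_; map; foldr; _++_; allFin)
open import Data.Bool using (Bool; true; false; if_then_else_; not; _∧_; _∨_)
open import Data.Product using (_×_; _,_; Σ-syntax)
open import Relation.Nullary.Decidable using (⌊_⌋)
open import Relation.Binary.PropositionalEquality using (_≡_)

-- Vertices of G_n: rung index i ∈ {0,…,n} (paper's i+1) and a side
-- (false = unprimed vertex i, true = primed vertex i').
V : ℕ → Set
V n = Fin (suc n) × Bool

vertices : (n : ℕ) → List (V n)
vertices n = foldr (λ i acc → (i , false) ∷ (i , true) ∷ acc) [] (allFin (suc n))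

_==ℕ_ : ℕ → ℕ → Bool
a ==ℕ b = ⌊ a ≟ b ⌋

_≠B_ : Bool → Bool → Bool
false ≠B b = b
true  ≠B b = not b

-- Adjacency of G_n: vertical edges ii', and for consecutive rungs i, i+1
-- all four edges i(i+1), i'(i+1)', i(i+1)', i'(i+1).
adj : (n : ℕ) → V n → V n → Bool
adj n (i , b) (j , c) =
  ((toℕ i ==ℕ toℕ j) ∧ (b ≠B c)) ∨ (suc (toℕ i) ==ℕ toℕ j) ∨ (suc (toℕ j) ==ℕ toℕ i)

sumℚ : List ℚ → ℚ
sumℚ = foldr _+ℚ_ 0ℚ

lap : (n : ℕ) → (V n → ℚ) → V n → ℚ
lap n x v = sumℚ (map (λ w → if adj n v w then x v -ℚ x w else 0ℚ) (vertices n))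

δ : (n : ℕ) → V n → V n → ℚ
δ n (i , b) (j , c) = if (toℕ i ==ℕ toℕ j) ∧ not (b ≠B c) then 1ℚ else 0ℚ

-- ρ is the effective resistance between u and v (unit resistors on edges):
-- ρ is the potential difference x u - x v for a potential x obeying
-- Kirchhoff's laws when a unit current enters at u and leaves at v,
-- i.e. L x = e_u - e_v.
IsEffRes : (n : ℕ) → V n → V n → ℚ → Set
IsEffRes n u v ρ =
  Σ[ x ∈ (V n → ℚ) ] ((∀ w → lap n x w ≡ δ n u w -ℚ δ n v w) × (ρ ≡ x u -ℚ x v))

pairSum : {A : Set} → (A → A → ℚ) → List A → ℚ
pairSum f [] = 0ℚ
pairSum f (a ∷ as) = sumℚ (map (f a) as) +ℚ pairSum f as

Kf : (n : ℕ) → (V n → V n → ℚ) → ℚ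
Kf n r = pairSum r (vertices n)

kfFormula : ℕ → ℚ
kfFormula n = (+ ((n + 1) * (n + 2) * (n + 2))) / 6

-- A function on the vertices is rung data X k d (rung k ∈ {0, …, n}, side d).
-- With s(k) = X k 0 + X k 1 and a(k) = X k 1 − X k 0 the Laplacian decouples:
--     (L X)(k, d) = (P s)(k) + sgn d · w(k) · a(k)          (lap-decomposition)
-- where P is the Laplacian of the path 0 — 1 — ⋯ — n formed by the rungs and
-- w(k) = 1 + deg_P(k).  Hence harmonic functions are constant (lap-kernel),
-- so effective resistances are unique, and the potential φ_u of a unit
-- current from u = (i, b) to the root (0, unprimed) is explicit:
-- s = min(·, i)/2 and a(k) = (sgn b [k = i] + [k = 0]) / (2 w(k))
-- (lap-grounded).  Then r(u, v) = (φ_u(u) − φ_u(v)) + (φ_v(v) − φ_v(u)), and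
-- summing over pairs (Kf-rungs) gives
--     Kf = (n + 1) Σ_i (i + 1/w(i)) − Σ_{i,k} min(i, k),
-- which the closed forms of the three sums turn into (n + 1)(n + 2)²/6.
-- The file develops, in order: sums in ℚ, vertices as rungs, the path graph,
-- the decomposition of L, its kernel, grounded potentials, resistances and the
-- evaluation of the index.

module Submission where

open import Defs
open import Data.Nat using (ℕ; zero; suc; _≤_; _<_; z≤n; s≤s; _≡ᵇ_; _<ᵇ_)
import Data.Nat as ℕ
import Data.Nat.Properties as ℕP
open import Data.Nat.Properties using (_≟_)
open import Data.Integer using () renaming (+_ to pos)
import Data.Integer as ℤ
import Data.Integer.Solver
open import Data.Rational using (ℚ; 0ℚ; 1ℚ; ½; _+_; _*_; _-_; -_; _/_; toℚᵘ; fromℚᵘ)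
open import Data.Rational.Properties
  using (+-assoc; +-comm; +-inverseʳ; +-identityˡ; +-identityʳ; *-zeroˡ; *-zeroʳ; *-distribˡ-+;
         +-0-group; fromℚᵘ-toℚᵘ; fromℚᵘ-cong; toℚᵘ-homo-+; toℚᵘ-homo-*)
open import Data.Rational.Unnormalised using (mkℚᵘ; *≡*) renaming (_≃_ to _≃ᵘ_)
import Data.Rational.Unnormalised.Properties as ℚᵘP
open import Data.Rational.Solver using (module +-*-Solver)
open import Algebra.Properties.Group +-0-group using (x∙y⁻¹≈ε⇒x≈y)
open import Data.Bool using (Bool; true; false; if_then_else_; not; _∧_; _∨_)
open import Data.Bool.Properties using (T-≡)
open import Function.Bundles using (Equivalence)
open import Data.Fin using (Fin; toℕ) renaming (zero to fzero; suc to fsuc)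
open import Data.Fin.Properties using (toℕ<n)
open import Data.List using ([]; _∷_; map; foldr; tabulate)
open import Data.Product using (_×_; _,_; proj₁; proj₂; Σ-syntax)
open import Data.Sum using (inj₁; inj₂)
open import Relation.Nullary.Decidable using (isYes≗does)
open import Relation.Binary.PropositionalEquality
open ≡-Reasoning
open +-*-Solver using (solve; _:=_; _:+_; _:*_; _:-_; con)
open Data.Integer.Solver.+-*-Solver using () renaming (solve to solveℤ; _:=_ to _≐_; _:+_ to _⊕_; _:*_ to _⊗_; con to κ)

+-interchange : ∀ a b c d → (a + b) + (c + d) ≡ (a + c) + (b + d)
+-interchange = solve 4 (λ a b c d → (a :+ b) :+ (c :+ d) := (a :+ c) :+ (b :+ d)) refl

−-interchange : ∀ a b c d → (a - b) + (c - d) ≡ (a + c) - (b + d)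
−-interchange = solve 4 (λ a b c d → (a :- b) :+ (c :- d) := (a :+ c) :- (b :+ d)) refl

-- The image of a natural number in ℚ, by recursion so that ⟦ suc k ⟧
-- unfolds to ⟦ k ⟧ + 1.
⟦_⟧ : ℕ → ℚ
⟦ zero ⟧ = 0ℚ
⟦ suc k ⟧ = ⟦ k ⟧ + 1ℚ

𝟙 : Bool → ℚ
𝟙 b = if b then 1ℚ else 0ℚ

sgn : Bool → ℚ
sgn false = - 1ℚ
sgn true = 1ℚ

-- The weights 1/3 of inner rungs and 1/6 of the final formula.
⅓ ⅙ : ℚ
⅓ = pos 1 / 3
⅙ = pos 1 / 6

Σ< : ℕ → (ℕ → ℚ) → ℚ
Σ< zero f = 0ℚ
Σ< (suc N) f = f 0 + Σ< N (λ m → f (suc m))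

Σ<-cong< : ∀ N {f g : ℕ → ℚ} → (∀ m → m < N → f m ≡ g m) → Σ< N f ≡ Σ< N g
Σ<-cong< zero e = refl
Σ<-cong< (suc N) e = cong₂ _+_ (e 0 (s≤s z≤n)) (Σ<-cong< N (λ m p → e (suc m) (s≤s p)))

Σ<-cong : ∀ N {f g : ℕ → ℚ} → (∀ m → f m ≡ g m) → Σ< N f ≡ Σ< N g
Σ<-cong N e = Σ<-cong< N (λ m _ → e m)

Σ<-+ : ∀ N (f g : ℕ → ℚ) → Σ< N (λ m → f m + g m) ≡ Σ< N f + Σ< N g
Σ<-+ zero f g = refl
Σ<-+ (suc N) f g = begin
  (f 0 + g 0) + Σ< N (λ m → f (suc m) + g (suc m))
    ≡⟨ cong ((f 0 + g 0) +_) (Σ<-+ N (λ m → f (suc m)) (λ m → g (suc m))) ⟩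
  (f 0 + g 0) + (Σ< N (λ m → f (suc m)) + Σ< N (λ m → g (suc m)))
    ≡⟨ +-interchange (f 0) (g 0) _ _ ⟩
  (f 0 + Σ< N (λ m → f (suc m))) + (g 0 + Σ< N (λ m → g (suc m))) ∎

Σ<-scale : ∀ N c (f : ℕ → ℚ) → Σ< N (λ m → c * f m) ≡ c * Σ< N f
Σ<-scale zero c f = sym (*-zeroʳ c)
Σ<-scale (suc N) c f = begin
  c * f 0 + Σ< N (λ m → c * f (suc m)) ≡⟨ cong (c * f 0 +_) (Σ<-scale N c (λ m → f (suc m))) ⟩
  c * f 0 + c * Σ< N (λ m → f (suc m)) ≡⟨ *-distribˡ-+ c (f 0) _ ⟨
  c * (f 0 + Σ< N (λ m → f (suc m)))   ∎

Σ<-- : ∀ N (f g : ℕ → ℚ) → Σ< N (λ m → f m - g m) ≡ Σ< N f - Σ< N g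
Σ<-- zero f g = refl
Σ<-- (suc N) f g = begin
  (f 0 - g 0) + Σ< N (λ m → f (suc m) - g (suc m))
    ≡⟨ cong ((f 0 - g 0) +_) (Σ<-- N (λ m → f (suc m)) (λ m → g (suc m))) ⟩
  (f 0 - g 0) + (Σ< N (λ m → f (suc m)) - Σ< N (λ m → g (suc m)))
    ≡⟨ −-interchange (f 0) (g 0) _ _ ⟩
  (f 0 + Σ< N (λ m → f (suc m))) - (g 0 + Σ< N (λ m → g (suc m))) ∎

Σ<-last : ∀ N (f : ℕ → ℚ) → Σ< (suc N) f ≡ Σ< N f + f N
Σ<-last zero f = +-comm (f 0) 0ℚ
Σ<-last (suc N) f = begin
  f 0 + Σ< (suc N) (λ m → f (suc m))       ≡⟨ cong (f 0 +_) (Σ<-last N (λ m → f (suc m))) ⟩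
  f 0 + (Σ< N (λ m → f (suc m)) + f (suc N)) ≡⟨ +-assoc (f 0) _ _ ⟨
  (f 0 + Σ< N (λ m → f (suc m))) + f (suc N) ∎

Σ<-const : ∀ N c → Σ< N (λ _ → c) ≡ ⟦ N ⟧ * c
Σ<-const zero c = sym (*-zeroˡ c)
Σ<-const (suc N) c = begin
  Σ< (suc N) (λ _ → c) ≡⟨ Σ<-last N (λ _ → c) ⟩
  Σ< N (λ _ → c) + c   ≡⟨ cong (_+ c) (Σ<-const N c) ⟩
  ⟦ N ⟧ * c + c        ≡⟨ solve 2 (λ x c → x :* c :+ c := (x :+ con 1ℚ) :* c) refl ⟦ N ⟧ c ⟩
  ⟦ suc N ⟧ * c        ∎

Σ<-zero : ∀ N → Σ< N (λ _ → 0ℚ) ≡ 0ℚ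
Σ<-zero N = trans (Σ<-const N 0ℚ) (*-zeroʳ ⟦ N ⟧)

Σ<-indicator : ∀ N j (f : ℕ → ℚ) → Σ< N (λ m → if j ≡ᵇ m then f m else 0ℚ) ≡ (if j <ᵇ N then f j else 0ℚ)
Σ<-indicator zero j f = refl
Σ<-indicator (suc N) zero f = begin
  f 0 + Σ< N (λ _ → 0ℚ) ≡⟨ cong (f 0 +_) (Σ<-zero N) ⟩
  f 0 + 0ℚ              ≡⟨ +-identityʳ (f 0) ⟩
  f 0                   ∎
Σ<-indicator (suc N) (suc j) f = begin
  0ℚ + Σ< N (λ m → if j ≡ᵇ m then f (suc m) else 0ℚ) ≡⟨ cong (0ℚ +_) (Σ<-indicator N j (λ m → f (suc m))) ⟩
  0ℚ + (if j <ᵇ N then f (suc j) else 0ℚ)            ≡⟨ +-identityˡ _ ⟩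
  (if j <ᵇ N then f (suc j) else 0ℚ)                  ∎

Σ<-id : ∀ N → Σ< N ⟦_⟧ ≡ (⟦ N ⟧ * (⟦ N ⟧ - 1ℚ)) * ½
Σ<-id zero = refl
Σ<-id (suc N) = begin
  Σ< (suc N) ⟦_⟧                                    ≡⟨ Σ<-last N ⟦_⟧ ⟩
  Σ< N ⟦_⟧ + ⟦ N ⟧                                  ≡⟨ cong (_+ ⟦ N ⟧) (Σ<-id N) ⟩
  (⟦ N ⟧ * (⟦ N ⟧ - 1ℚ)) * ½ + ⟦ N ⟧                ≡⟨ solve 1 (λ x → (x :* (x :- con 1ℚ)) :* con ½ :+ x
                                                         := ((x :+ con 1ℚ) :* ((x :+ con 1ℚ) :- con 1ℚ)) :* con ½) refl ⟦ N ⟧ ⟩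
  (⟦ suc N ⟧ * (⟦ suc N ⟧ - 1ℚ)) * ½                ∎

<ᵇ-true : ∀ {m n} → m < n → (m <ᵇ n) ≡ true
<ᵇ-true m<n = Equivalence.to T-≡ (ℕP.<⇒<ᵇ m<n)

<ᵇ-false : ∀ {m n} → n ≤ m → (m <ᵇ n) ≡ false
<ᵇ-false {m} {zero} _ = refl
<ᵇ-false {suc m} {suc n} (s≤s n≤m) = <ᵇ-false n≤m

≡ᵇ-sound : ∀ {m n} → (m ≡ᵇ n) ≡ true → m ≡ n
≡ᵇ-sound e = ℕP.≡ᵇ⇒≡ _ _ (Equivalence.from T-≡ e)

≡ᵇ-refl : ∀ n → (n ≡ᵇ n) ≡ true
≡ᵇ-refl n = Equivalence.to T-≡ (ℕP.≡⇒≡ᵇ n n refl)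

≡ᵇ-comm : ∀ m n → (m ≡ᵇ n) ≡ (n ≡ᵇ m)
≡ᵇ-comm zero zero = refl
≡ᵇ-comm zero (suc n) = refl
≡ᵇ-comm (suc m) zero = refl
≡ᵇ-comm (suc m) (suc n) = ≡ᵇ-comm m n

1+n≢ᵇn : ∀ n → (suc n ≡ᵇ n) ≡ false
1+n≢ᵇn zero = refl
1+n≢ᵇn (suc n) = 1+n≢ᵇn n

2+n≢ᵇn : ∀ n → (suc (suc n) ≡ᵇ n) ≡ false
2+n≢ᵇn zero = refl
2+n≢ᵇn (suc n) = 2+n≢ᵇn n

==ℕ-≡ᵇ : ∀ m n → (m ==ℕ n) ≡ (m ≡ᵇ n)
==ℕ-≡ᵇ m n = isYes≗does (m ≟ n)

sumℚ-cong : ∀ {A : Set} {f g : A → ℚ} → (∀ a → f a ≡ g a) → ∀ l → sumℚ (map f l) ≡ sumℚ (map g l)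
sumℚ-cong e [] = refl
sumℚ-cong e (a ∷ l) = cong₂ _+_ (e a) (sumℚ-cong e l)

sumℚ-+ : ∀ {A : Set} (f g : A → ℚ) l → sumℚ (map (λ a → f a + g a) l) ≡ sumℚ (map f l) + sumℚ (map g l)
sumℚ-+ f g [] = refl
sumℚ-+ f g (a ∷ l) = trans (cong ((f a + g a) +_) (sumℚ-+ f g l)) (+-interchange (f a) (g a) _ _)

sumℚ-- : ∀ {A : Set} (f g : A → ℚ) l → sumℚ (map (λ a → f a - g a) l) ≡ sumℚ (map f l) - sumℚ (map g l)
sumℚ-- f g [] = refl
sumℚ-- f g (a ∷ l) = trans (cong ((f a - g a) +_) (sumℚ-- f g l)) (−-interchange (f a) (g a) _ _)

pairSum-cong : ∀ {A : Set} {f g : A → A → ℚ} → (∀ a b → f a b ≡ g a b) → ∀ l → pairSum f l ≡ pairSum g l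
pairSum-cong e [] = refl
pairSum-cong e (a ∷ l) = cong₂ _+_ (sumℚ-cong (e a) l) (pairSum-cong e l)

pairSum-symmetrise : ∀ {A : Set} (h : A → A → ℚ) → (∀ a → h a a ≡ 0ℚ) → ∀ l →
  pairSum (λ a b → h a b + h b a) l ≡ sumℚ (map (λ a → sumℚ (map (h a) l)) l)
pairSum-symmetrise h h-diag [] = refl
pairSum-symmetrise h h-diag (x ∷ l) = begin
  sumℚ (map (λ b → h x b + h b x) l) + pairSum (λ a b → h a b + h b a) l
    ≡⟨ cong₂ _+_ (sumℚ-+ (h x) (λ b → h b x) l) (pairSum-symmetrise h h-diag l) ⟩
  (Hx + Cx) + R
    ≡⟨ cong (λ t → (t + Cx) + R) (+-identityˡ Hx) ⟨
  (0ℚ + Hx + Cx) + R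
    ≡⟨ cong (λ t → (t + Hx + Cx) + R) (h-diag x) ⟨
  (h x x + Hx + Cx) + R
    ≡⟨ solve 4 (λ d a c r → (d :+ a :+ c) :+ r := (d :+ a) :+ (c :+ r)) refl (h x x) Hx Cx R ⟩
  (h x x + Hx) + (Cx + R)
    ≡⟨ cong ((h x x + Hx) +_) (sumℚ-+ (λ a → h a x) (λ a → sumℚ (map (h a) l)) l) ⟨
  (h x x + Hx) + sumℚ (map (λ a → h a x + sumℚ (map (h a) l)) l) ∎
  where
  Hx = sumℚ (map (h x) l)
  Cx = sumℚ (map (λ b → h b x) l)
  R = sumℚ (map (λ a → sumℚ (map (h a) l)) l)

-- The vertex 1 of the paper, where the grounded potentials are pinned.
root : ∀ {n} → V n
root = (fzero , false)

liftV : ∀ {n} → (ℕ → Bool → ℚ) → V n → ℚ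
liftV X (i , b) = X (toℕ i) b

sumOverVertices : ∀ n (g : V n → ℚ) (G : ℕ → Bool → ℚ) → (∀ i b → g (i , b) ≡ G (toℕ i) b) →
  sumℚ (map g (vertices n)) ≡ Σ< (suc n) (λ m → G m false + G m true)
sumOverVertices n g G g≗G = go (suc n) (λ l → l) (λ m → G m false + G m true) (λ l → cong₂ _+_ (g≗G l false) (g≗G l true))
  where
  go : ∀ N (f : Fin N → Fin (suc n)) (H : ℕ → ℚ) → (∀ l → g (f l , false) + g (f l , true) ≡ H (toℕ l)) →
       sumℚ (map g (foldr (λ i acc → (i , false) ∷ (i , true) ∷ acc) [] (tabulate f))) ≡ Σ< N H
  go zero f H e = refl
  go (suc N) f H e = trans (sym (+-assoc (g (f fzero , false)) (g (f fzero , true)) _))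
                           (cong₂ _+_ (e fzero) (go N (λ l → f (fsuc l)) (λ m → H (suc m)) (λ l → e (fsuc l))))

-- Rung m of the path 0 — 1 — ⋯ — n as an element of Fin (suc n), saturating at n.
clamp : (n : ℕ) → ℕ → Fin (suc n)
clamp n zero = fzero
clamp zero (suc m) = fzero
clamp (suc n) (suc m) = fsuc (clamp n m)

clamp-toℕ : ∀ n (i : Fin (suc n)) → clamp n (toℕ i) ≡ i
clamp-toℕ n fzero = refl
clamp-toℕ (suc n) (fsuc i) = cong fsuc (clamp-toℕ n i)

toℕ-clamp : ∀ n m → m ≤ n → toℕ (clamp n m) ≡ m
toℕ-clamp n zero _ = refl
toℕ-clamp (suc n) (suc m) (s≤s m≤n) = cong suc (toℕ-clamp n m m≤n)

toℕ≤ : ∀ {n} (i : Fin (suc n)) → toℕ i ≤ n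
toℕ≤ i = ℕP.≤-pred (toℕ<n i)

above : ℕ → (ℕ → ℚ) → ℕ → ℚ
above n g k = if k <ᵇ n then g (suc k) else 0ℚ

below : (ℕ → ℚ) → ℕ → ℚ
below g zero = 0ℚ
below g (suc k) = g k

nbrSum : ℕ → (ℕ → ℚ) → ℕ → ℚ
nbrSum n g k = above n g k + below g k

-- Path degree, and the weight 1 + degree that governs the antisymmetric
-- part of the Laplacian of G_n (the vertical edge adds the 1).
degree : ℕ → ℕ → ℚ
degree n k = nbrSum n (λ _ → 1ℚ) k

weight : ℕ → ℕ → ℚ
weight n k = 1ℚ + degree n k

pathLap : ℕ → (ℕ → ℚ) → ℕ → ℚ
pathLap n s k = nbrSum n (λ m → s k - s m) k

above-< : ∀ {n k} (g : ℕ → ℚ) → k < n → above n g k ≡ g (suc k)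
above-< {n} {k} g k<n rewrite <ᵇ-true k<n = refl

above-≥ : ∀ {n k} (g : ℕ → ℚ) → n ≤ k → above n g k ≡ 0ℚ
above-≥ {n} {k} g n≤k rewrite <ᵇ-false n≤k = refl

nbrSum-cong : ∀ n k {g h : ℕ → ℚ} → (∀ m → g m ≡ h m) → nbrSum n g k ≡ nbrSum n h k
nbrSum-cong n zero e = cong (λ t → (if 0 <ᵇ n then t else 0ℚ) + 0ℚ) (e 1)
nbrSum-cong n (suc k) e = cong₂ (λ t u → (if suc k <ᵇ n then t else 0ℚ) + u) (e (suc (suc k))) (e k)

nbrSum-scale : ∀ n k c (g : ℕ → ℚ) → nbrSum n (λ m → c * g m) k ≡ c * nbrSum n g k
nbrSum-scale n zero c g with 0 <ᵇ n
... | true = solve 2 (λ c a → c :* a :+ con 0ℚ := c :* (a :+ con 0ℚ)) refl c (g 1)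
... | false = solve 1 (λ c → con 0ℚ :+ con 0ℚ := c :* (con 0ℚ :+ con 0ℚ)) refl c
nbrSum-scale n (suc k) c g with suc k <ᵇ n
... | true = solve 3 (λ c a b → c :* a :+ c :* b := c :* (a :+ b)) refl c (g (suc (suc k))) (g k)
... | false = solve 2 (λ c b → con 0ℚ :+ c :* b := c :* (con 0ℚ :+ b)) refl c (g k)

nbrSum-shift : ∀ n k (g : ℕ → ℚ) t → nbrSum n (λ m → g m + t) k ≡ nbrSum n g k + t * degree n k
nbrSum-shift n zero g t with 0 <ᵇ n
... | true = solve 2 (λ a t → (a :+ t) :+ con 0ℚ := (a :+ con 0ℚ) :+ t :* (con 1ℚ :+ con 0ℚ)) refl (g 1) t
... | false = solve 1 (λ t → con 0ℚ :+ con 0ℚ := (con 0ℚ :+ con 0ℚ) :+ t :* (con 0ℚ :+ con 0ℚ)) refl t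
nbrSum-shift n (suc k) g t with suc k <ᵇ n
... | true = solve 3 (λ a b t → (a :+ t) :+ (b :+ t) := (a :+ b) :+ t :* (con 1ℚ :+ con 1ℚ)) refl (g (suc (suc k))) (g k) t
... | false = solve 2 (λ b t → con 0ℚ :+ (b :+ t) := (con 0ℚ :+ b) :+ t :* (con 0ℚ :+ con 1ℚ)) refl (g k) t

pathLap-cong : ∀ n k {s t : ℕ → ℚ} → (∀ m → s m ≡ t m) → pathLap n s k ≡ pathLap n t k
pathLap-cong n k e = nbrSum-cong n k (λ m → cong₂ _-_ (e k) (e m))

pathLap-scale : ∀ n k c (s : ℕ → ℚ) → pathLap n (λ m → c * s m) k ≡ c * pathLap n s k
pathLap-scale n k c s = trans (nbrSum-cong n k (λ m → sym (*-distribˡ-− (s k) (s m))))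
                              (nbrSum-scale n k c (λ m → s k - s m))
  where
  *-distribˡ-− : ∀ a b → c * (a - b) ≡ c * a - c * b
  *-distribˡ-− a b = solve 3 (λ c a b → c :* (a :- b) := c :* a :- c :* b) refl c a b

pathHarmonic-constant : ∀ n (s : ℕ → ℚ) → (∀ k → k ≤ n → pathLap n s k ≡ 0ℚ) → ∀ k → k ≤ n → s k ≡ s 0
pathHarmonic-constant n s harmonic = constant
  where
  diff≡0 : ∀ a b → a - b ≡ 0ℚ → a ≡ b
  diff≡0 = x∙y⁻¹≈ε⇒x≈y

  flat : ∀ k → suc k ≤ n → s (suc k) ≡ s k
  flat zero 0<n = sym (diff≡0 (s 0) (s 1) (begin
    s 0 - s 1                     ≡⟨ +-identityʳ (s 0 - s 1) ⟨
    (s 0 - s 1) + 0ℚ              ≡⟨ cong (_+ 0ℚ) (above-< (λ m → s 0 - s m) 0<n) ⟨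
    pathLap n s 0                 ≡⟨ harmonic 0 z≤n ⟩
    0ℚ                            ∎))
  flat (suc k) k+1<n = sym (diff≡0 (s (suc k)) (s (suc (suc k))) (begin
    s (suc k) - s (suc (suc k))
      ≡⟨ solve 2 (λ a c → a :- c := (a :- c) :+ (a :- a)) refl (s (suc k)) (s (suc (suc k))) ⟩
    (s (suc k) - s (suc (suc k))) + (s (suc k) - s (suc k))
      ≡⟨ cong (λ t → (s (suc k) - s (suc (suc k))) + (s (suc k) - t)) (flat k (ℕP.<⇒≤ k+1<n)) ⟩
    (s (suc k) - s (suc (suc k))) + (s (suc k) - s k)
      ≡⟨ cong (_+ (s (suc k) - s k)) (above-< (λ m → s (suc k) - s m) k+1<n) ⟨
    pathLap n s (suc k)
      ≡⟨ harmonic (suc k) (ℕP.<⇒≤ k+1<n) ⟩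
    0ℚ ∎))

  constant : ∀ k → k ≤ n → s k ≡ s 0
  constant zero _ = refl
  constant (suc k) k<n = trans (flat k k<n) (constant k (ℕP.<⇒≤ k<n))

adjacentRungs : ℕ → Bool → ℕ → Bool → Bool
adjacentRungs k d m c = ((k ≡ᵇ m) ∧ (d ≠B c)) ∨ (suc k ≡ᵇ m) ∨ (suc m ≡ᵇ k)

adj-rungs : ∀ n (i j : Fin (suc n)) b c → adj n (i , b) (j , c) ≡ adjacentRungs (toℕ i) b (toℕ j) c
adj-rungs n i j b c =
  cong₂ _∨_ (cong (_∧ (b ≠B c)) (==ℕ-≡ᵇ i′ j′)) (cong₂ _∨_ (==ℕ-≡ᵇ (suc i′) j′) (==ℕ-≡ᵇ (suc j′) i′))
  where
  i′ = toℕ i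
  j′ = toℕ j

same⇒¬next : ∀ k m → (k ≡ᵇ m) ≡ true → (suc k ≡ᵇ m) ≡ false
same⇒¬next k m e = subst (λ j → (suc j ≡ᵇ m) ≡ false) (sym (≡ᵇ-sound {k} e)) (1+n≢ᵇn m)

same⇒¬previous : ∀ k m → (k ≡ᵇ m) ≡ true → (suc m ≡ᵇ k) ≡ false
same⇒¬previous k m e = subst (λ j → (suc m ≡ᵇ j) ≡ false) (sym (≡ᵇ-sound {k} e)) (1+n≢ᵇn m)

next⇒¬previous : ∀ k m → (suc k ≡ᵇ m) ≡ true → (suc m ≡ᵇ k) ≡ false
next⇒¬previous k m e = subst (λ j → (suc j ≡ᵇ k) ≡ false) (≡ᵇ-sound {suc k} e) (2+n≢ᵇn k)

rung-split : ∀ (e₁ e₂ e₃ : Bool) d (A : Bool → ℚ) →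
  (e₁ ≡ true → e₂ ≡ false) → (e₁ ≡ true → e₃ ≡ false) → (e₂ ≡ true → e₃ ≡ false) →
  (if (e₁ ∧ (d ≠B false)) ∨ e₂ ∨ e₃ then A false else 0ℚ) + (if (e₁ ∧ (d ≠B true)) ∨ e₂ ∨ e₃ then A true else 0ℚ)
  ≡ (if e₁ then A (not d) else 0ℚ) + ((if e₂ then A false + A true else 0ℚ) + (if e₃ then A false + A true else 0ℚ))
rung-split true true _ _ _ h₁₂ _ _ with () ← h₁₂ refl
rung-split true false true _ _ _ h₁₃ _ with () ← h₁₃ refl
rung-split false true true _ _ _ _ h₂₃ with () ← h₂₃ refl
rung-split true false false false A _ _ _ = solve 1 (λ a → con 0ℚ :+ a := a :+ (con 0ℚ :+ con 0ℚ)) refl (A true)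
rung-split true false false true A _ _ _ = solve 1 (λ a → a :+ con 0ℚ := a :+ (con 0ℚ :+ con 0ℚ)) refl (A false)
rung-split false true false d A _ _ _ = solve 2 (λ a b → a :+ b := con 0ℚ :+ ((a :+ b) :+ con 0ℚ)) refl (A false) (A true)
rung-split false false true d A _ _ _ = solve 2 (λ a b → a :+ b := con 0ℚ :+ (con 0ℚ :+ (a :+ b))) refl (A false) (A true)
rung-split false false false d A _ _ _ = refl

Σ<-indicator-below : ∀ N k (f : ℕ → ℚ) → k ≤ N →
  Σ< (suc N) (λ m → if suc m ≡ᵇ k then f m else 0ℚ) ≡ below f k
Σ<-indicator-below N zero f _ = Σ<-zero (suc N)
Σ<-indicator-below N (suc k) f k<N = begin
  Σ< (suc N) (λ m → if m ≡ᵇ k then f m else 0ℚ) ≡⟨ Σ<-cong (suc N) (λ m → cong (λ b → if b then f m else 0ℚ) (≡ᵇ-comm m k)) ⟩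
  Σ< (suc N) (λ m → if k ≡ᵇ m then f m else 0ℚ) ≡⟨ Σ<-indicator (suc N) k f ⟩
  (if k <ᵇ suc N then f k else 0ℚ)            ≡⟨ cong (λ b → if b then f k else 0ℚ) (<ᵇ-true (ℕP.m≤n⇒m≤1+n k<N)) ⟩
  f k                                          ∎

lap-local : ∀ n X (i : Fin (suc n)) d → let k = toℕ i in
  lap n (liftV X) (i , d) ≡ (X k d - X k (not d)) + nbrSum n (λ m → (X k d - X m false) + (X k d - X m true)) k
lap-local n X i d = begin
  lap n (liftV X) (i , d)
    ≡⟨ sumOverVertices n _ G (λ j c → cong (λ e → if e then X k d - X (toℕ j) c else 0ℚ) (adj-rungs n i j d c)) ⟩
  Σ< (suc n) (λ m → G m false + G m true)
    ≡⟨ Σ<-cong (suc n) (λ m → rung-split _ _ _ d (λ c → X k d - X m c) (same⇒¬next k m) (same⇒¬previous k m) (next⇒¬previous k m)) ⟩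
  Σ< (suc n) (λ m → T₁ m + (T₂ m + T₃ m))
    ≡⟨ trans (Σ<-+ (suc n) T₁ (λ m → T₂ m + T₃ m)) (cong (Σ< (suc n) T₁ +_) (Σ<-+ (suc n) T₂ T₃)) ⟩
  Σ< (suc n) T₁ + (Σ< (suc n) T₂ + Σ< (suc n) T₃)
    ≡⟨ cong₂ _+_ same-rung (cong₂ _+_ (Σ<-indicator (suc n) (suc k) E) (Σ<-indicator-below n k E k≤n)) ⟩
  (X k d - X k (not d)) + (above n E k + below E k) ∎
  where
  k = toℕ i
  k≤n = toℕ≤ i
  G : ℕ → Bool → ℚ
  G m c = if adjacentRungs k d m c then X k d - X m c else 0ℚ
  E : ℕ → ℚ
  E m = (X k d - X m false) + (X k d - X m true)
  T₁ T₂ T₃ : ℕ → ℚ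
  T₁ m = if k ≡ᵇ m then X k d - X m (not d) else 0ℚ
  T₂ m = if suc k ≡ᵇ m then E m else 0ℚ
  T₃ m = if suc m ≡ᵇ k then E m else 0ℚ
  same-rung : Σ< (suc n) T₁ ≡ X k d - X k (not d)
  same-rung = trans (Σ<-indicator (suc n) k (λ m → X k d - X m (not d)))
                    (cong (λ b → if b then X k d - X k (not d) else 0ℚ) (<ᵇ-true (s≤s k≤n)))

symPart : (ℕ → Bool → ℚ) → ℕ → ℚ
symPart X k = X k false + X k true

antiPart : (ℕ → Bool → ℚ) → ℕ → ℚ
antiPart X k = X k true - X k false

assemble : (ℕ → ℚ) → (ℕ → ℚ) → ℕ → Bool → ℚ
assemble s a k d = (s k + sgn d * a k) * ½

symPart-assemble : ∀ s a k → symPart (assemble s a) k ≡ s k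
symPart-assemble s a k =
  solve 2 (λ s a → (s :+ con (- 1ℚ) :* a) :* con ½ :+ (s :+ con 1ℚ :* a) :* con ½ := s) refl (s k) (a k)

antiPart-assemble : ∀ s a k → antiPart (assemble s a) k ≡ a k
antiPart-assemble s a k =
  solve 2 (λ s a → (s :+ con 1ℚ :* a) :* con ½ :- (s :+ con (- 1ℚ) :* a) :* con ½ := a) refl (s k) (a k)

assemble-parts : ∀ X k d → X k d ≡ assemble (symPart X) (antiPart X) k d
assemble-parts X k false =
  solve 2 (λ x y → x := ((x :+ y) :+ con (- 1ℚ) :* (y :- x)) :* con ½) refl (X k false) (X k true)
assemble-parts X k true =
  solve 2 (λ x y → y := ((x :+ y) :+ con 1ℚ :* (y :- x)) :* con ½) refl (X k false) (X k true)

lap-decomposition : ∀ n X (i : Fin (suc n)) d → let k = toℕ i in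
  lap n (liftV X) (i , d) ≡ pathLap n (symPart X) k + sgn d * (weight n k * antiPart X k)
lap-decomposition n X i d = begin
  lap n (liftV X) (i , d)
    ≡⟨ lap-local n X i d ⟩
  (X k d - X k (not d)) + nbrSum n (λ m → (X k d - X m false) + (X k d - X m true)) k
    ≡⟨ cong₂ _+_ (vertical d) (nbrSum-cong n k (neighbour d)) ⟩
  sgn d * a + nbrSum n (λ m → (s k - s m) + sgn d * a) k
    ≡⟨ cong (sgn d * a +_) (nbrSum-shift n k (λ m → s k - s m) (sgn d * a)) ⟩
  sgn d * a + (pathLap n s k + (sgn d * a) * degree n k)
    ≡⟨ solve 4 (λ σ a p δ → σ :* a :+ (p :+ (σ :* a) :* δ) := p :+ σ :* ((con 1ℚ :+ δ) :* a)) refl (sgn d) a (pathLap n s k) (degree n k) ⟩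
  pathLap n s k + sgn d * (weight n k * a) ∎
  where
  k = toℕ i
  s = symPart X
  a = antiPart X k
  vertical : ∀ d → X k d - X k (not d) ≡ sgn d * a
  vertical false = solve 2 (λ x y → x :- y := con (- 1ℚ) :* (y :- x)) refl (X k false) (X k true)
  vertical true = solve 2 (λ x y → y :- x := con 1ℚ :* (y :- x)) refl (X k false) (X k true)
  neighbour : ∀ d m → (X k d - X m false) + (X k d - X m true) ≡ (s k - s m) + sgn d * a
  neighbour false m = solve 4 (λ x y u v → (x :- u) :+ (x :- v) := ((x :+ y) :- (u :+ v)) :+ con (- 1ℚ) :* (y :- x))
                            refl (X k false) (X k true) (X m false) (X m true)
  neighbour true m = solve 4 (λ x y u v → (y :- u) :+ (y :- v) := ((x :+ y) :- (u :+ v)) :+ con 1ℚ :* (y :- x))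
                           refl (X k false) (X k true) (X m false) (X m true)

lap-cong : ∀ n {x y : V n → ℚ} → (∀ w → x w ≡ y w) → ∀ v → lap n x v ≡ lap n y v
lap-cong n e v = sumℚ-cong (λ w → cong (λ t → if adj n v w then t else 0ℚ) (cong₂ _-_ (e v) (e w))) (vertices n)

lap-difference : ∀ n (x y : V n → ℚ) v → lap n (λ w → x w - y w) v ≡ lap n x v - lap n y v
lap-difference n x y v = trans (sumℚ-cong term (vertices n)) (sumℚ-- (edge x) (edge y) (vertices n))
  where
  edge : (V n → ℚ) → V n → ℚ
  edge f w = if adj n v w then f v - f w else 0ℚ
  term : ∀ w → (if adj n v w then (x v - y v) - (x w - y w) else 0ℚ) ≡ edge x w - edge y w
  term w with adj n v w
  ... | true = solve 4 (λ a b c d → (a :- b) :- (c :- d) := (a :- c) :- (b :- d)) refl (x v) (y v) (x w) (y w)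
  ... | false = refl

-- Reciprocal of the weight: 1/2 at the two end rungs and 1/3 inside
-- (valid as soon as the path has an edge, n ≥ 1).
invWeight : ℕ → ℕ → ℚ
invWeight n zero = ½
invWeight n (suc k) = if suc k <ᵇ n then ⅓ else ½

weight-inverse : ∀ {n} → 1 ≤ n → ∀ k → invWeight n k * weight n k ≡ 1ℚ
weight-inverse {suc n} _ zero = refl
weight-inverse {n} _ (suc k) with suc k <ᵇ n
... | true = refl
... | false = refl

harmonic-rung : ∀ {p w ι a} → ι * w ≡ 1ℚ →
  p + sgn false * (w * a) ≡ 0ℚ → p + sgn true * (w * a) ≡ 0ℚ → p ≡ 0ℚ × a ≡ 0ℚ
harmonic-rung {p} {w} {ι} {a} ιw≡1 e₀ e₁ = p≡0 , a≡0
  where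
  p≡0 : p ≡ 0ℚ
  p≡0 = begin
    p                                         ≡⟨ solve 2 (λ p t → p := ((p :+ con (- 1ℚ) :* t) :+ (p :+ con 1ℚ :* t)) :* con ½) refl p (w * a) ⟩
    ((p + (- 1ℚ) * (w * a)) + (p + 1ℚ * (w * a))) * ½ ≡⟨ cong₂ (λ u v → (u + v) * ½) e₀ e₁ ⟩
    0ℚ                                        ∎
  a≡0 : a ≡ 0ℚ
  a≡0 = begin
    a                                         ≡⟨ solve 4 (λ p w ι a → a := ι :* (((p :+ con 1ℚ :* (w :* a)) :- (p :+ con (- 1ℚ) :* (w :* a))) :* con ½) :+ (con 1ℚ :- ι :* w) :* a) refl p w ι a ⟩
    ι * (((p + 1ℚ * (w * a)) - (p + (- 1ℚ) * (w * a))) * ½) + (1ℚ - ι * w) * a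
                                              ≡⟨ cong₂ (λ u v → ι * ((u - v) * ½) + (1ℚ - ι * w) * a) e₁ e₀ ⟩
    ι * ((0ℚ - 0ℚ) * ½) + (1ℚ - ι * w) * a    ≡⟨ cong (λ t → ι * ((0ℚ - 0ℚ) * ½) + (1ℚ - t) * a) ιw≡1 ⟩
    ι * ((0ℚ - 0ℚ) * ½) + (1ℚ - 1ℚ) * a       ≡⟨ solve 2 (λ ι a → ι :* ((con 0ℚ :- con 0ℚ) :* con ½) :+ (con 1ℚ :- con 1ℚ) :* a := con 0ℚ) refl ι a ⟩
    0ℚ                                        ∎

harmonic-parts : ∀ n → 1 ≤ n → ∀ X → (∀ w → lap n (liftV X) w ≡ 0ℚ) →
  ∀ k → k ≤ n → pathLap n (symPart X) k ≡ 0ℚ × antiPart X k ≡ 0ℚ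
harmonic-parts n 1≤n X harmonic k k≤n =
  harmonic-rung {w = weight n k} {ι = invWeight n k} (weight-inverse 1≤n k) (equation false) (equation true)
  where
  k′ = toℕ (clamp n k)
  equation : ∀ d → pathLap n (symPart X) k + sgn d * (weight n k * antiPart X k) ≡ 0ℚ
  equation d = begin
    pathLap n (symPart X) k + sgn d * (weight n k * antiPart X k)
      ≡⟨ cong (λ j → pathLap n (symPart X) j + sgn d * (weight n j * antiPart X j)) (toℕ-clamp n k k≤n) ⟨
    pathLap n (symPart X) k′ + sgn d * (weight n k′ * antiPart X k′)
      ≡⟨ lap-decomposition n X (clamp n k) d ⟨
    lap n (liftV X) (clamp n k , d)
      ≡⟨ harmonic (clamp n k , d) ⟩
    0ℚ ∎

lap-kernel : ∀ n → 1 ≤ n → (z : V n → ℚ) → (∀ w → lap n z w ≡ 0ℚ) → ∀ u → z u ≡ z root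
lap-kernel n 1≤n z harmonic (i , d) = begin
  z (i , d)              ≡⟨ z≗liftZ (i , d) ⟩
  Z (toℕ i) d            ≡⟨ flat (toℕ i) (toℕ≤ i) d ⟩
  ½ * symPart Z 0        ≡⟨ flat 0 z≤n false ⟨
  z root                 ∎
  where
  Z : ℕ → Bool → ℚ
  Z m c = z (clamp n m , c)
  z≗liftZ : ∀ w → z w ≡ liftV Z w
  z≗liftZ (j , c) = cong (λ j′ → z (j′ , c)) (sym (clamp-toℕ n j))
  parts = harmonic-parts n 1≤n Z (λ w → trans (sym (lap-cong n z≗liftZ w)) (harmonic w))
  flat : ∀ k → k ≤ n → ∀ d → Z k d ≡ ½ * symPart Z 0
  flat k k≤n d = begin
    Z k d                                     ≡⟨ assemble-parts Z k d ⟩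
    (symPart Z k + sgn d * antiPart Z k) * ½  ≡⟨ cong₂ (λ u v → (u + sgn d * v) * ½) (pathHarmonic-constant n (symPart Z) (λ j j≤n → proj₁ (parts j j≤n)) k k≤n) (proj₂ (parts k k≤n)) ⟩
    (symPart Z 0 + sgn d * 0ℚ) * ½            ≡⟨ solve 2 (λ s σ → (s :+ σ :* con 0ℚ) :* con ½ := con ½ :* s) refl (symPart Z 0) (sgn d) ⟩
    ½ * symPart Z 0                           ∎

-- ramp i k = min (k, i): on the path, the potential of a unit current
-- entering at rung i and leaving at rung 0.
ramp : ℕ → ℕ → ℚ
ramp i zero = 0ℚ
ramp i (suc k) = ramp i k + 𝟙 (k <ᵇ i)

ramp-below : ∀ {i k} → k ≤ i → ramp i k ≡ ⟦ k ⟧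
ramp-below {i} {zero} _ = refl
ramp-below {i} {suc k} k<i = cong₂ _+_ (ramp-below (ℕP.<⇒≤ k<i)) (cong 𝟙 (<ᵇ-true k<i))

ramp-above : ∀ {i k} → i ≤ k → ramp i k ≡ ⟦ i ⟧
ramp-above {k = zero} z≤n = refl
ramp-above {i} {suc k} i≤1+k with ℕP.m≤n⇒m<n∨m≡n i≤1+k
... | inj₁ (s≤s i≤k) = trans (cong₂ _+_ (ramp-above i≤k) (cong 𝟙 (<ᵇ-false i≤k))) (+-identityʳ ⟦ i ⟧)
... | inj₂ refl = ramp-below {i} ℕP.≤-refl

ramp-jump : ∀ k i → 𝟙 (k <ᵇ i) - 𝟙 (suc k <ᵇ i) ≡ 𝟙 (i ≡ᵇ suc k)
ramp-jump k zero = refl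
ramp-jump zero (suc zero) = refl
ramp-jump zero (suc (suc i)) = refl
ramp-jump (suc k) (suc i) = ramp-jump k i

pathLap-ramp : ∀ {n i} → i ≤ n → ∀ k → pathLap n (ramp i) k ≡ 𝟙 (i ≡ᵇ k) - 𝟙 (0 ≡ᵇ k)
pathLap-ramp {n} {zero} _ zero with 0 <ᵇ n
... | true = refl
... | false = refl
pathLap-ramp {n} {suc i} i<n zero = cong (_+ 0ℚ) (above-< (λ m → 0ℚ - ramp (suc i) m) (ℕP.<-≤-trans (s≤s z≤n) i<n))
pathLap-ramp {n} {i} i≤n (suc k) = begin
  above n (λ m → R₁ - ramp i m) (suc k) + (R₁ - R₀)      ≡⟨ cong (_+ (R₁ - R₀)) upper ⟩
  (0ℚ - 𝟙 (suc k <ᵇ i)) + ((R₀ + 𝟙 (k <ᵇ i)) - R₀)       ≡⟨ solve 3 (λ r a b → (con 0ℚ :- b) :+ ((r :+ a) :- r) := a :- b) refl R₀ (𝟙 (k <ᵇ i)) (𝟙 (suc k <ᵇ i)) ⟩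
  𝟙 (k <ᵇ i) - 𝟙 (suc k <ᵇ i)                            ≡⟨ ramp-jump k i ⟩
  𝟙 (i ≡ᵇ suc k)                                          ≡⟨ +-identityʳ _ ⟨
  𝟙 (i ≡ᵇ suc k) - 0ℚ                                     ∎
  where
  R₀ = ramp i k
  R₁ = ramp i (suc k)
  upper : above n (λ m → R₁ - ramp i m) (suc k) ≡ 0ℚ - 𝟙 (suc k <ᵇ i)
  upper with ℕP.<-≤-connex (suc k) n
  ... | inj₁ k+1<n = trans (above-< (λ m → R₁ - ramp i m) k+1<n)
                           (solve 2 (λ r b → r :- (r :+ b) := con 0ℚ :- b) refl R₁ (𝟙 (suc k <ᵇ i)))
  ... | inj₂ n≤k+1 = trans (above-≥ (λ m → R₁ - ramp i m) n≤k+1)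
                           (cong (λ b → 0ℚ - 𝟙 b) (sym (<ᵇ-false (ℕP.≤-trans i≤n n≤k+1))))

δ-split : ∀ n (i j : Fin (suc n)) b d → δ n (i , b) (j , d) ≡ 𝟙 (toℕ i ≡ᵇ toℕ j) * ((1ℚ + sgn b * sgn d) * ½)
δ-split n i j b d = trans (cong (λ e → if e ∧ not (b ≠B d) then 1ℚ else 0ℚ) (==ℕ-≡ᵇ (toℕ i) (toℕ j)))
                          (sides (toℕ i ≡ᵇ toℕ j) b d)
  where
  sides : ∀ e b d → (if e ∧ not (b ≠B d) then 1ℚ else 0ℚ) ≡ 𝟙 e * ((1ℚ + sgn b * sgn d) * ½)
  sides false b d = sym (*-zeroˡ ((1ℚ + sgn b * sgn d) * ½))
  sides true false false = refl
  sides true false true = refl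
  sides true true false = refl
  sides true true true = refl

-- The potential of a unit current entering at (i, b) and leaving at the
-- root (0, unprimed): symmetric part ramp i / 2 and antisymmetric part
-- supported on the rungs i and 0.
groundSym : ℕ → ℕ → ℚ
groundSym i k = ½ * ramp i k

groundAnti : ℕ → ℕ → Bool → ℕ → ℚ
groundAnti n i b k = (sgn b * 𝟙 (i ≡ᵇ k) + 𝟙 (0 ≡ᵇ k)) * (invWeight n k * ½)

grounded : ℕ → ℕ → Bool → ℕ → Bool → ℚ
grounded n i b = assemble (groundSym i) (groundAnti n i b)

φ : ∀ n → V n → V n → ℚ
φ n (i , b) = liftV (grounded n (toℕ i) b)

lap-grounded : ∀ n → 1 ≤ n → ∀ u w → lap n (φ n u) w ≡ δ n u w - δ n root w
lap-grounded n 1≤n (i , b) (j , d) = begin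
  lap n (liftV Φ) (j , d)
    ≡⟨ lap-decomposition n Φ j d ⟩
  pathLap n (symPart Φ) k + sgn d * (weight n k * antiPart Φ k)
    ≡⟨ cong₂ (λ p a → p + sgn d * (weight n k * a)) (pathLap-cong n k (symPart-assemble (groundSym i′) (groundAnti n i′ b))) (antiPart-assemble (groundSym i′) (groundAnti n i′ b) k) ⟩
  pathLap n (groundSym i′) k + sgn d * (weight n k * groundAnti n i′ b k)
    ≡⟨ cong₂ (λ p a → p + sgn d * a) symmetric antisymmetric ⟩
  ½ * (I - O) + sgn d * ((sgn b * I + O) * ½)
    ≡⟨ solve 4 (λ I O β σ → con ½ :* (I :- O) :+ σ :* ((β :* I :+ O) :* con ½)
                           := I :* ((con 1ℚ :+ β :* σ) :* con ½) :- O :* ((con 1ℚ :+ con (- 1ℚ) :* σ) :* con ½))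
             refl I O (sgn b) (sgn d) ⟩
  I * ((1ℚ + sgn b * sgn d) * ½) - O * ((1ℚ + sgn false * sgn d) * ½)
    ≡⟨ cong₂ _-_ (δ-split n i j b d) (δ-split n fzero j false d) ⟨
  δ n (i , b) (j , d) - δ n root (j , d) ∎
  where
  i′ = toℕ i
  k = toℕ j
  Φ = grounded n i′ b
  I = 𝟙 (i′ ≡ᵇ k)
  O = 𝟙 (0 ≡ᵇ k)
  symmetric : pathLap n (groundSym i′) k ≡ ½ * (I - O)
  symmetric = trans (pathLap-scale n k ½ (ramp i′)) (cong (½ *_) (pathLap-ramp (toℕ≤ i) k))
  antisymmetric : weight n k * groundAnti n i′ b k ≡ (sgn b * I + O) * ½
  antisymmetric = begin
    weight n k * ((sgn b * I + O) * (invWeight n k * ½))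
      ≡⟨ solve 4 (λ w c ι h → w :* (c :* (ι :* h)) := c :* ((ι :* w) :* h)) refl (weight n k) (sgn b * I + O) (invWeight n k) ½ ⟩
    (sgn b * I + O) * ((invWeight n k * weight n k) * ½)
      ≡⟨ cong (λ t → (sgn b * I + O) * (t * ½)) (weight-inverse 1≤n k) ⟩
    (sgn b * I + O) * (1ℚ * ½) ∎

-- Two potentials for the same unit current give the same potential
-- difference: their difference is harmonic, hence constant.
effRes-unique : ∀ n → 1 ≤ n → ∀ u v {r r′} → IsEffRes n u v r → IsEffRes n u v r′ → r ≡ r′
effRes-unique n 1≤n u v {r} {r′} (x , x-flow , r≡) (y , y-flow , r′≡) = begin
  r                                   ≡⟨ r≡ ⟩
  x u - x v                           ≡⟨ solve 4 (λ a b c d → a :- b := ((a :- c) :- (b :- d)) :+ (c :- d)) refl (x u) (x v) (y u) (y v) ⟩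
  (z u - z v) + (y u - y v)           ≡⟨ cong (λ t → (t - z v) + (y u - y v)) (trans (constant u) (sym (constant v))) ⟩
  (z v - z v) + (y u - y v)           ≡⟨ cong (_+ (y u - y v)) (+-inverseʳ (z v)) ⟩
  0ℚ + (y u - y v)                    ≡⟨ +-identityˡ (y u - y v) ⟩
  y u - y v                           ≡⟨ r′≡ ⟨
  r′                                  ∎
  where
  z : V n → ℚ
  z w = x w - y w
  harmonic : ∀ w → lap n z w ≡ 0ℚ
  harmonic w = begin
    lap n z w                                     ≡⟨ lap-difference n x y w ⟩
    lap n x w - lap n y w                         ≡⟨ cong₂ _-_ (x-flow w) (y-flow w) ⟩
    (δ n u w - δ n v w) - (δ n u w - δ n v w)     ≡⟨ +-inverseʳ (δ n u w - δ n v w) ⟩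
    0ℚ                                            ∎
  constant : ∀ w → z w ≡ z root
  constant = lap-kernel n 1≤n z harmonic

drop : ∀ n → V n → V n → ℚ
drop n a b = φ n a a - φ n a b

resistance : ∀ n → V n → V n → ℚ
resistance n u v = drop n u v + drop n v u

-- φ_u − φ_v is a potential for the unit current from u to v.
resistance-isEffRes : ∀ n → 1 ≤ n → ∀ u v → IsEffRes n u v (resistance n u v)
resistance-isEffRes n 1≤n u v = x , flow , sym x-drop
  where
  x : V n → ℚ
  x w = φ n u w - φ n v w
  flow : ∀ w → lap n x w ≡ δ n u w - δ n v w
  flow w = begin
    lap n x w                                       ≡⟨ lap-difference n (φ n u) (φ n v) w ⟩
    lap n (φ n u) w - lap n (φ n v) w               ≡⟨ cong₂ _-_ (lap-grounded n 1≤n u w) (lap-grounded n 1≤n v w) ⟩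
    (δ n u w - δ n root w) - (δ n v w - δ n root w) ≡⟨ solve 3 (λ a b c → (a :- c) :- (b :- c) := a :- b) refl (δ n u w) (δ n v w) (δ n root w) ⟩
    δ n u w - δ n v w                               ∎
  x-drop : x u - x v ≡ resistance n u v
  x-drop = solve 4 (λ a b c d → (a :- b) :- (c :- d) := (a :- c) :+ (d :- b)) refl (φ n u u) (φ n v u) (φ n u v) (φ n v v)

diagonal : ∀ n i → grounded n i false i false + grounded n i true i true ≡ ½ * (⟦ i ⟧ + invWeight n i)
diagonal n i rewrite ≡ᵇ-refl i | ramp-below {i} ℕP.≤-refl =
  solve 3 (λ x ι o → (con ½ :* x :+ con (- 1ℚ) :* ((con (- 1ℚ) :* con 1ℚ :+ o) :* (ι :* con ½))) :* con ½
                   :+ (con ½ :* x :+ con 1ℚ :* ((con 1ℚ :* con 1ℚ :+ o) :* (ι :* con ½))) :* con ½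
                   := con ½ :* (x :+ ι))
          refl ⟦ i ⟧ (invWeight n i) (𝟙 (0 ≡ᵇ i))

drop-row : ∀ n (i : Fin (suc n)) b → let i′ = toℕ i; D = grounded n i′ b i′ b in
  sumℚ (map (drop n (i , b)) (vertices n)) ≡ ⟦ suc n ⟧ * (D + D) - ½ * Σ< (suc n) (ramp i′)
drop-row n i b = begin
  sumℚ (map (drop n (i , b)) (vertices n))
    ≡⟨ sumOverVertices n (drop n (i , b)) (λ m c → D - Φ m c) (λ _ _ → refl) ⟩
  Σ< (suc n) (λ m → (D - Φ m false) + (D - Φ m true))
    ≡⟨ Σ<-cong (suc n) (λ m → trans (−-interchange D (Φ m false) D (Φ m true)) (cong (λ t → (D + D) - t) (symPart-assemble (groundSym i′) (groundAnti n i′ b) m))) ⟩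
  Σ< (suc n) (λ m → (D + D) - ½ * ramp i′ m)
    ≡⟨ Σ<-- (suc n) (λ _ → D + D) (λ m → ½ * ramp i′ m) ⟩
  Σ< (suc n) (λ _ → D + D) - Σ< (suc n) (λ m → ½ * ramp i′ m)
    ≡⟨ cong₂ _-_ (Σ<-const (suc n) (D + D)) (Σ<-scale (suc n) ½ (ramp i′)) ⟩
  ⟦ suc n ⟧ * (D + D) - ½ * Σ< (suc n) (ramp i′) ∎
  where
  i′ = toℕ i
  Φ = grounded n i′ b
  D = Φ i′ b

Kf-rungs : ∀ n → Kf n (resistance n) ≡ Σ< (suc n) (λ i → ⟦ suc n ⟧ * (⟦ i ⟧ + invWeight n i) - Σ< (suc n) (ramp i))
Kf-rungs n = begin
  pairSum (λ a b → drop n a b + drop n b a) (vertices n)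
    ≡⟨ pairSum-symmetrise (drop n) (λ a → +-inverseʳ (φ n a a)) (vertices n) ⟩
  sumℚ (map (λ a → sumℚ (map (drop n a) (vertices n))) (vertices n))
    ≡⟨ sumOverVertices n _ row (λ i b → drop-row n i b) ⟩
  Σ< (suc n) (λ i → row i false + row i true)
    ≡⟨ Σ<-cong (suc n) both-sides ⟩
  Σ< (suc n) (λ i → ⟦ suc n ⟧ * (⟦ i ⟧ + invWeight n i) - Σ< (suc n) (ramp i)) ∎
  where
  row : ℕ → Bool → ℚ
  row i b = ⟦ suc n ⟧ * (grounded n i b i b + grounded n i b i b) - ½ * Σ< (suc n) (ramp i)
  both-sides : ∀ i → row i false + row i true ≡ ⟦ suc n ⟧ * (⟦ i ⟧ + invWeight n i) - Σ< (suc n) (ramp i)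
  both-sides i = begin
    row i false + row i true
      ≡⟨ solve 4 (λ N f t R → (N :* (f :+ f) :- con ½ :* R) :+ (N :* (t :+ t) :- con ½ :* R) := (N :* ((con 1ℚ :+ con 1ℚ) :* (f :+ t))) :- R)
               refl ⟦ suc n ⟧ (grounded n i false i false) (grounded n i true i true) (Σ< (suc n) (ramp i)) ⟩
    ⟦ suc n ⟧ * ((1ℚ + 1ℚ) * (grounded n i false i false + grounded n i true i true)) - Σ< (suc n) (ramp i)
      ≡⟨ cong (λ t → ⟦ suc n ⟧ * ((1ℚ + 1ℚ) * t) - Σ< (suc n) (ramp i)) (diagonal n i) ⟩
    ⟦ suc n ⟧ * ((1ℚ + 1ℚ) * (½ * (⟦ i ⟧ + invWeight n i))) - Σ< (suc n) (ramp i)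
      ≡⟨ cong (λ t → ⟦ suc n ⟧ * t - Σ< (suc n) (ramp i)) (solve 1 (λ y → (con 1ℚ :+ con 1ℚ) :* (con ½ :* y) := y) refl (⟦ i ⟧ + invWeight n i)) ⟩
    ⟦ suc n ⟧ * (⟦ i ⟧ + invWeight n i) - Σ< (suc n) (ramp i) ∎

Σ<-invWeight : ∀ m → Σ< (suc (suc m)) (invWeight (suc m)) ≡ ½ + (⟦ m ⟧ * ⅓ + ½)
Σ<-invWeight m = cong (½ +_) (begin
  Σ< (suc m) (λ k → invWeight (suc m) (suc k))                          ≡⟨ Σ<-last m (λ k → invWeight (suc m) (suc k)) ⟩
  Σ< m (λ k → invWeight (suc m) (suc k)) + invWeight (suc m) (suc m)    ≡⟨ cong₂ _+_ interior end ⟩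
  ⟦ m ⟧ * ⅓ + ½                                                          ∎)
  where
  interior : Σ< m (λ k → invWeight (suc m) (suc k)) ≡ ⟦ m ⟧ * ⅓
  interior = trans (Σ<-cong< m (λ k k<m → cong (λ b → if b then ⅓ else ½) (<ᵇ-true k<m))) (Σ<-const m ⅓)
  end : invWeight (suc m) (suc m) ≡ ½
  end = cong (λ b → if b then ⅓ else ½) (<ᵇ-false {m} ℕP.≤-refl)

Σ<-ramp : ∀ N → Σ< N (λ i → Σ< N (ramp i)) ≡ ((⟦ N ⟧ - 1ℚ) * ⟦ N ⟧ * (⟦ N ⟧ + ⟦ N ⟧ - 1ℚ)) * ⅙
Σ<-ramp zero = refl
Σ<-ramp (suc N) = begin
  Σ< (suc N) (λ i → Σ< (suc N) (ramp i))
    ≡⟨ Σ<-cong (suc N) (λ i → Σ<-last N (ramp i)) ⟩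
  Σ< (suc N) (λ i → Σ< N (ramp i) + ramp i N)
    ≡⟨ Σ<-+ (suc N) (λ i → Σ< N (ramp i)) (λ i → ramp i N) ⟩
  Σ< (suc N) (λ i → Σ< N (ramp i)) + Σ< (suc N) (λ i → ramp i N)
    ≡⟨ cong₂ _+_ (Σ<-last N (λ i → Σ< N (ramp i))) (Σ<-last N (λ i → ramp i N)) ⟩
  (Σ< N (λ i → Σ< N (ramp i)) + Σ< N (ramp N)) + (Σ< N (λ i → ramp i N) + ramp N N)
    ≡⟨ cong₂ (λ u v → (Σ< N (λ i → Σ< N (ramp i)) + u) + (v + ramp N N))
             (Σ<-cong< N (λ k k<N → ramp-below (ℕP.<⇒≤ k<N))) (Σ<-cong< N (λ i i<N → ramp-above (ℕP.<⇒≤ i<N))) ⟩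
  (Σ< N (λ i → Σ< N (ramp i)) + Σ< N ⟦_⟧) + (Σ< N ⟦_⟧ + ramp N N)
    ≡⟨ cong₂ (λ u v → (u + v) + (v + ramp N N)) (Σ<-ramp N) (Σ<-id N) ⟩
  (((x - 1ℚ) * x * (x + x - 1ℚ)) * ⅙ + (x * (x - 1ℚ)) * ½) + ((x * (x - 1ℚ)) * ½ + ramp N N)
    ≡⟨ cong (λ t → (((x - 1ℚ) * x * (x + x - 1ℚ)) * ⅙ + (x * (x - 1ℚ)) * ½) + ((x * (x - 1ℚ)) * ½ + t)) (ramp-below {N} ℕP.≤-refl) ⟩
  (((x - 1ℚ) * x * (x + x - 1ℚ)) * ⅙ + (x * (x - 1ℚ)) * ½) + ((x * (x - 1ℚ)) * ½ + x)
    ≡⟨ solve 1 (λ x → (((x :- con 1ℚ) :* x :* (x :+ x :- con 1ℚ)) :* con ⅙ :+ (x :* (x :- con 1ℚ)) :* con ½) :+ ((x :* (x :- con 1ℚ)) :* con ½ :+ x)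
                   := (((x :+ con 1ℚ) :- con 1ℚ) :* (x :+ con 1ℚ) :* ((x :+ con 1ℚ) :+ (x :+ con 1ℚ) :- con 1ℚ)) :* con ⅙) refl x ⟩
  ((⟦ suc N ⟧ - 1ℚ) * ⟦ suc N ⟧ * (⟦ suc N ⟧ + ⟦ suc N ⟧ - 1ℚ)) * ⅙ ∎
  where
  x = ⟦ N ⟧

⟦⟧-+ : ∀ a b → ⟦ a ℕ.+ b ⟧ ≡ ⟦ a ⟧ + ⟦ b ⟧
⟦⟧-+ zero b = sym (+-identityˡ ⟦ b ⟧)
⟦⟧-+ (suc a) b = begin
  ⟦ a ℕ.+ b ⟧ + 1ℚ       ≡⟨ cong (_+ 1ℚ) (⟦⟧-+ a b) ⟩
  (⟦ a ⟧ + ⟦ b ⟧) + 1ℚ   ≡⟨ solve 2 (λ x y → (x :+ y) :+ con 1ℚ := (x :+ con 1ℚ) :+ y) refl ⟦ a ⟧ ⟦ b ⟧ ⟩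
  (⟦ a ⟧ + 1ℚ) + ⟦ b ⟧   ∎

⟦⟧-* : ∀ a b → ⟦ a ℕ.* b ⟧ ≡ ⟦ a ⟧ * ⟦ b ⟧
⟦⟧-* zero b = sym (*-zeroˡ ⟦ b ⟧)
⟦⟧-* (suc a) b = begin
  ⟦ b ℕ.+ a ℕ.* b ⟧      ≡⟨ ⟦⟧-+ b (a ℕ.* b) ⟩
  ⟦ b ⟧ + ⟦ a ℕ.* b ⟧    ≡⟨ cong (⟦ b ⟧ +_) (⟦⟧-* a b) ⟩
  ⟦ b ⟧ + ⟦ a ⟧ * ⟦ b ⟧  ≡⟨ solve 2 (λ x y → y :+ x :* y := (x :+ con 1ℚ) :* y) refl ⟦ a ⟧ ⟦ b ⟧ ⟩
  (⟦ a ⟧ + 1ℚ) * ⟦ b ⟧   ∎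

⟦⟧-toℚᵘ : ∀ k → toℚᵘ ⟦ k ⟧ ≃ᵘ mkℚᵘ (pos k) 0
⟦⟧-toℚᵘ zero = *≡* refl
⟦⟧-toℚᵘ (suc k) = ℚᵘP.≃-trans (toℚᵘ-homo-+ ⟦ k ⟧ 1ℚ) (ℚᵘP.≃-trans (ℚᵘP.+-congˡ (toℚᵘ 1ℚ) (⟦⟧-toℚᵘ k)) (*≡* (k+1 (pos k))))
  where
  k+1 : ∀ x → (x ℤ.* pos 1 ℤ.+ pos 1 ℤ.* pos 1) ℤ.* pos 1 ≡ (pos 1 ℤ.+ x) ℤ.* pos 1
  k+1 = solveℤ 1 (λ x → (x ⊗ κ (pos 1) ⊕ κ (pos 1) ⊗ κ (pos 1)) ⊗ κ (pos 1) ≐ (κ (pos 1) ⊕ x) ⊗ κ (pos 1)) refl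

/6≡⟦⟧*⅙ : ∀ k → pos k / 6 ≡ ⟦ k ⟧ * ⅙
/6≡⟦⟧*⅙ k = sym (begin
  ⟦ k ⟧ * ⅙                     ≡⟨ fromℚᵘ-toℚᵘ (⟦ k ⟧ * ⅙) ⟨
  fromℚᵘ (toℚᵘ (⟦ k ⟧ * ⅙))     ≡⟨ fromℚᵘ-cong {y = mkℚᵘ (pos k) 5} (ℚᵘP.≃-trans (toℚᵘ-homo-* ⟦ k ⟧ ⅙) (ℚᵘP.≃-trans (ℚᵘP.*-congʳ (⟦⟧-toℚᵘ k)) (*≡* (k/6 (pos k))))) ⟩
  pos k / 6                     ∎)
  where
  k/6 : ∀ x → (x ℤ.* pos 1) ℤ.* pos 6 ≡ x ℤ.* pos 6
  k/6 = solveℤ 1 (λ x → (x ⊗ κ (pos 1)) ⊗ κ (pos 6) ≐ x ⊗ κ (pos 6)) refl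

kfFormula-⟦⟧ : ∀ n → kfFormula n ≡ ((⟦ n ⟧ + ⟦ 1 ⟧) * (⟦ n ⟧ + ⟦ 2 ⟧) * (⟦ n ⟧ + ⟦ 2 ⟧)) * ⅙
kfFormula-⟦⟧ n = begin
  pos ((n ℕ.+ 1) ℕ.* (n ℕ.+ 2) ℕ.* (n ℕ.+ 2)) / 6      ≡⟨ /6≡⟦⟧*⅙ ((n ℕ.+ 1) ℕ.* (n ℕ.+ 2) ℕ.* (n ℕ.+ 2)) ⟩
  ⟦ (n ℕ.+ 1) ℕ.* (n ℕ.+ 2) ℕ.* (n ℕ.+ 2) ⟧ * ⅙         ≡⟨ cong (_* ⅙) product ⟩
  ((⟦ n ⟧ + ⟦ 1 ⟧) * (⟦ n ⟧ + ⟦ 2 ⟧) * (⟦ n ⟧ + ⟦ 2 ⟧)) * ⅙ ∎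
  where
  product : ⟦ (n ℕ.+ 1) ℕ.* (n ℕ.+ 2) ℕ.* (n ℕ.+ 2) ⟧ ≡ (⟦ n ⟧ + ⟦ 1 ⟧) * (⟦ n ⟧ + ⟦ 2 ⟧) * (⟦ n ⟧ + ⟦ 2 ⟧)
  product = begin
    ⟦ (n ℕ.+ 1) ℕ.* (n ℕ.+ 2) ℕ.* (n ℕ.+ 2) ⟧        ≡⟨ ⟦⟧-* ((n ℕ.+ 1) ℕ.* (n ℕ.+ 2)) (n ℕ.+ 2) ⟩
    ⟦ (n ℕ.+ 1) ℕ.* (n ℕ.+ 2) ⟧ * ⟦ n ℕ.+ 2 ⟧        ≡⟨ cong (_* ⟦ n ℕ.+ 2 ⟧) (⟦⟧-* (n ℕ.+ 1) (n ℕ.+ 2)) ⟩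
    ⟦ n ℕ.+ 1 ⟧ * ⟦ n ℕ.+ 2 ⟧ * ⟦ n ℕ.+ 2 ⟧          ≡⟨ cong₂ (λ a b → a * b * b) (⟦⟧-+ n 1) (⟦⟧-+ n 2) ⟩
    (⟦ n ⟧ + ⟦ 1 ⟧) * (⟦ n ⟧ + ⟦ 2 ⟧) * (⟦ n ⟧ + ⟦ 2 ⟧) ∎

Kf-closed : ∀ n → 1 ≤ n → Kf n (resistance n) ≡ kfFormula n
Kf-closed (suc m) _ = begin
  Kf (suc m) (resistance (suc m))
    ≡⟨ Kf-rungs (suc m) ⟩
  Σ< N (λ i → ⟦ N ⟧ * (⟦ i ⟧ + ι i) - Σ< N (ramp i))
    ≡⟨ Σ<-- N (λ i → ⟦ N ⟧ * (⟦ i ⟧ + ι i)) (λ i → Σ< N (ramp i)) ⟩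
  Σ< N (λ i → ⟦ N ⟧ * (⟦ i ⟧ + ι i)) - Σ< N (λ i → Σ< N (ramp i))
    ≡⟨ cong (_- Σ< N (λ i → Σ< N (ramp i))) (trans (Σ<-scale N ⟦ N ⟧ (λ i → ⟦ i ⟧ + ι i)) (cong (⟦ N ⟧ *_) (Σ<-+ N ⟦_⟧ ι))) ⟩
  ⟦ N ⟧ * (Σ< N ⟦_⟧ + Σ< N ι) - Σ< N (λ i → Σ< N (ramp i))
    ≡⟨ cong₂ (λ u v → ⟦ N ⟧ * (u + v) - Σ< N (λ i → Σ< N (ramp i))) (Σ<-id N) (Σ<-invWeight m) ⟩
  ⟦ N ⟧ * ((⟦ N ⟧ * (⟦ N ⟧ - 1ℚ)) * ½ + (½ + (x * ⅓ + ½))) - Σ< N (λ i → Σ< N (ramp i))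
    ≡⟨ cong (λ w → ⟦ N ⟧ * ((⟦ N ⟧ * (⟦ N ⟧ - 1ℚ)) * ½ + (½ + (x * ⅓ + ½))) - w) (Σ<-ramp N) ⟩
  ⟦ N ⟧ * ((⟦ N ⟧ * (⟦ N ⟧ - 1ℚ)) * ½ + (½ + (x * ⅓ + ½))) - ((⟦ N ⟧ - 1ℚ) * ⟦ N ⟧ * (⟦ N ⟧ + ⟦ N ⟧ - 1ℚ)) * ⅙
    ≡⟨ solve 1 (λ x → let y = (x :+ con 1ℚ) :+ con 1ℚ in
                 y :* ((y :* (y :- con 1ℚ)) :* con ½ :+ (con ½ :+ (x :* con ⅓ :+ con ½)))
                   :- ((y :- con 1ℚ) :* y :* (y :+ y :- con 1ℚ)) :* con ⅙
                 := (((x :+ con 1ℚ) :+ (con 0ℚ :+ con 1ℚ)) :* ((x :+ con 1ℚ) :+ ((con 0ℚ :+ con 1ℚ) :+ con 1ℚ))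
                      :* ((x :+ con 1ℚ) :+ ((con 0ℚ :+ con 1ℚ) :+ con 1ℚ))) :* con ⅙) refl x ⟩
  ((⟦ suc m ⟧ + ⟦ 1 ⟧) * (⟦ suc m ⟧ + ⟦ 2 ⟧) * (⟦ suc m ⟧ + ⟦ 2 ⟧)) * ⅙
    ≡⟨ kfFormula-⟦⟧ (suc m) ⟨
  kfFormula (suc m) ∎
  where
  N = suc (suc m)
  x = ⟦ m ⟧
  ι = invWeight (suc m)

theorem3p1 : (n : ℕ) → 1 ≤ n →
    (Σ[ r ∈ (V n → V n → ℚ) ] (∀ u v → IsEffRes n u v (r u v)))
    × (∀ (r : V n → V n → ℚ) → (∀ u v → IsEffRes n u v (r u v)) → Kf n r ≡ kfFormula n)
theorem3p1 n 1≤n = (resistance n , resistance-isEffRes n 1≤n) , Kf≡formula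
  where
  Kf≡formula : ∀ r → (∀ u v → IsEffRes n u v (r u v)) → Kf n r ≡ kfFormula n
  Kf≡formula r r-eff = begin
    Kf n r               ≡⟨ pairSum-cong (λ u v → effRes-unique n 1≤n u v (r-eff u v) (resistance-isEffRes n 1≤n u v)) (vertices n) ⟩
    Kf n (resistance n)  ≡⟨ Kf-closed n 1≤n ⟩
    kfFormula n          ∎
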